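{- Let $k\in\mathbb{N}_0$ and let $Q=\{(p_i,q_i)\mid i\in\{0,\ldots,k\}\}$ with $p_i\in\mathbb{N}_0$, $q_i\in\mathbb{N}$, $p_i\le q_i$, $(p_i,q_i)\ne t(p_j,q_j)$ for $i\ne j$, $t\in\mathbb{N}$, and $(p_0,q_0)=(0,1)$. Let $\pi=\pi_Q$ be defined recursively by: $\pi(n)$ is the least non-negative integer distinct from $\frac{q_i\pi(j)+p_i(n-j)}{q_i}$ for all $i$ and all $j\in\{0,\ldots,n-1\}$, and distinct from $\frac{p_i\pi(j)+q_i(n-j)}{p_i}$ for all such $j$ and all $i$ with $0<p_i\ne q_i$. Let $(a_i)_{i\in\mathbb{N}_0}$ be the increasing enumeration of $\{n\in\mathbb{N}_0\mid \pi(n)\ge n\}$. Then for every $N\in\mathbb{N}$, $$\#\{i\mid a_i\le N\}>\frac{N}{2}.$$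
   Context: The pairs $\{a_i,\pi(a_i)\}$ describe the $P$-positions of the take-away game $Q\mathrm{GDWN}$, in which from $(x,y)\in\mathbb{N}_0^2$ one may move to $(x-m,y-n)\in\mathbb{N}_0^2$ whenever $(m,n)=(tp_i,tq_i)$ or $(tq_i,tp_i)$ for some $t\in\mathbb{N}$ and some $i$. -}

module Defs where

open import Data.Nat using (ℕ; zero; suc; _+_; _*_; _∸_; _≤_; _<_; _≤?_)
open import Data.Fin using (Fin)
open import Data.Product using (Σ; ∃; _×_; _,_)
open import Data.Sum using (_⊎_)
open import Data.List using (List; length; filter; upTo)
open import Relation.Nullary using (¬_)
open import Relation.Binary.PropositionalEquality using (_≡_; _≢_)

record MoveSet (k : ℕ) : Set where
  field
    p q      : Fin (suc k) → ℕ
    q-pos    : ∀ i → 1 ≤ q i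
    p≤q      : ∀ i → p i ≤ q i
    no-mult  : ∀ i j → i ≢ j → ∀ t → 1 ≤ t →
               ¬ (p i ≡ t * p j × q i ≡ t * q j)
    p0       : p Fin.zero ≡ 0
    q0       : q Fin.zero ≡ 1
open MoveSet public

-- m is excluded as a value of π(n), given the earlier values π(j), j < n.
-- "m ≠ (q_i π(j) + p_i (n-j)) / q_i" is written multiplied out (q_i > 0),
-- likewise for the second family (p_i > 0).
Forbidden : ∀ {k} → MoveSet k → (ℕ → ℕ) → ℕ → ℕ → Set
Forbidden Q π n m =
  Σ (Fin _) λ i → Σ ℕ λ j → j < n ×
    ( (q Q i * m ≡ q Q i * π j + p Q i * (n ∸ j))
    ⊎ (0 < p Q i × p Q i ≢ q Q i × p Q i * m ≡ p Q i * π j + q Q i * (n ∸ j)) )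

IsPi : ∀ {k} → MoveSet k → (ℕ → ℕ) → Set
IsPi Q π = ∀ n → ¬ Forbidden Q π n (π n) × (∀ m → m < π n → Forbidden Q π n m)

-- #{ i | a_i ≤ N } where (a_i) enumerates {n | π(n) ≥ n} increasingly,
-- i.e. the number of n ∈ {0,…,N} with n ≤ π(n).
countUpTo : (ℕ → ℕ) → ℕ → ℕ
countUpTo π N = length (filter (λ n → n ≤? π n) (upTo (suc N)))

-- The recursion defining π says precisely that the graph {(n , π n)} is the
-- kernel (the set of P-positions) of a subtraction game on ℕ × ℕ whose moves
-- go in a direction (p_i , q_i) or (q_i , p_i). That game is symmetric under
-- swapping the coordinates, and a well-founded game has only one kernel, so
-- the graph is symmetric: π is an involution. For an involution, n ↦ π n maps
-- {n ≤ N | π n < n} injectively into {m ≤ N | m < π m}, so at least half of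
-- 0, …, N satisfy n ≤ π n. Incrementally in N this is the invariant
--   N + 1 + #{n ≤ N | N < π n} ≤ 2 · #{n ≤ N | n ≤ π n},
-- preserved as N grows.
module Submission where

open import Defs
open import Level using (0ℓ)
open import Data.Nat using (ℕ; zero; suc; _+_; _*_; _∸_; _<_; _≤_; _≤?_; _<?_; z≤n; s≤s; >-nonZero)
open import Data.Nat.Properties
open import Data.Nat.Induction using (<-wellFounded)
open import Data.Fin using (Fin)
open import Data.Product using (∃-syntax; _×_; _,_; proj₁; proj₂; swap; uncurry)
open import Data.Sum using (_⊎_; inj₁; inj₂)
open import Data.Empty using (⊥-elim)
open import Data.List using (filter; upTo; length; [_]; _++_)
open import Data.List.Properties using (upTo-∷ʳ; filter-++; length-++)
open import Function using (_∘_; flip)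
open import Induction.WellFounded using (WellFounded; module Subrelation; module All)
open import Relation.Binary using (Rel; tri<; tri≈; tri>)
import Relation.Binary.Construct.On as On
open import Relation.Nullary using (¬_; yes; no)
open import Relation.Unary using (Pred; Decidable)
open import Relation.Binary.PropositionalEquality using (_≡_; refl; sym; trans; cong; subst; subst₂; module ≡-Reasoning)

module _ {P : Pred ℕ 0ℓ} (P? : Decidable P) where

  count : ℕ → ℕ
  count zero = 0
  count (suc m) with P? m
  ... | yes _ = suc (count m)
  ... | no _ = count m

  count-suc-yes : ∀ {m} → P m → count (suc m) ≡ suc (count m)
  count-suc-yes {m} Pm with P? m
  ... | yes _ = refl
  ... | no ¬Pm = ⊥-elim (¬Pm Pm)

  count-suc-no : ∀ {m} → ¬ P m → count (suc m) ≡ count m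
  count-suc-no {m} ¬Pm with P? m
  ... | yes Pm = ⊥-elim (¬Pm Pm)
  ... | no _ = refl

  count-suc-≤ : ∀ m → count (suc m) ≤ suc (count m)
  count-suc-≤ m with P? m
  ... | yes _ = ≤-refl
  ... | no _ = n≤1+n (count m)

  count-≤-suc : ∀ m → count m ≤ count (suc m)
  count-≤-suc m with P? m
  ... | yes _ = n≤1+n (count m)
  ... | no _ = ≤-refl

  length-filter-upTo : ∀ m → length (filter P? (upTo m)) ≡ count m
  length-filter-upTo zero = refl
  length-filter-upTo (suc m) = begin
    length (filter P? (upTo (suc m)))                ≡⟨ cong (length ∘ filter P?) (sym (upTo-∷ʳ m)) ⟩
    length (filter P? (upTo m ++ [ m ]))             ≡⟨ cong length (filter-++ P? (upTo m) [ m ]) ⟩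
    length (filter P? (upTo m) ++ filter P? [ m ])   ≡⟨ length-++ (filter P? (upTo m)) ⟩
    length (filter P? (upTo m)) + length (filter P? [ m ])
                                                     ≡⟨ cong (_+ length (filter P? [ m ])) (length-filter-upTo m) ⟩
    count m + length (filter P? [ m ])               ≡⟨ last-step ⟩
    count (suc m)                                    ∎
    where
    open ≡-Reasoning
    last-step : count m + length (filter P? [ m ]) ≡ count (suc m)
    last-step with P? m
    ... | yes _ = +-comm (count m) 1
    ... | no _ = +-identityʳ (count m)

module _ {P R : Pred ℕ 0ℓ} (P? : Decidable P) (R? : Decidable R) where

  count-mono : ∀ {m} → (∀ {n} → n < m → P n → R n) → count P? m ≤ count R? m
  count-mono {zero} _ = z≤n
  count-mono {suc m} P⇒R with P? m | R? m | count-mono {m} (P⇒R ∘ m<n⇒m<1+n)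
  ... | yes _  | yes _  | ih = s≤s ih
  ... | yes Pm | no ¬Rm | _  = ⊥-elim (¬Rm (P⇒R (n<1+n m) Pm))
  ... | no _   | yes _  | ih = m≤n⇒m≤1+n ih
  ... | no _   | no _   | ih = ih

  count-< : ∀ {m k} → (∀ {n} → n < m → P n → R n) →
            k < m → ¬ P k → R k → count P? m < count R? m
  count-< {suc m} {k} P⇒R k<1+m ¬Pk Rk with m≤n⇒m<n∨m≡n (≤-pred k<1+m)
  ... | inj₂ refl rewrite count-suc-no P? ¬Pk | count-suc-yes R? Rk =
    s≤s (count-mono (P⇒R ∘ m<n⇒m<1+n))
  ... | inj₁ k<m with P? m | count-< {m} (P⇒R ∘ m<n⇒m<1+n) k<m ¬Pk Rk
  ...   | yes Pm | ih rewrite count-suc-yes R? (P⇒R (n<1+n m) Pm) = s≤s ih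
  ...   | no _   | ih = <-≤-trans ih (count-≤-suc R? m)

module _ {A : Set} (_⟶_ : Rel A 0ℓ) where

  record IsKernel (K : Pred A 0ℓ) : Set where
    field
      independent : ∀ {x y} → K x → K y → ¬ x ⟶ y
      absorbing   : ∀ x → K x ⊎ ∃[ y ] x ⟶ y × K y
  open IsKernel

  kernel-preimage : ∀ {K} (f : A → A) → (∀ {x y} → x ⟶ y → f x ⟶ f y) →
                    (∀ x → f (f x) ≡ x) → IsKernel K → IsKernel (K ∘ f)
  kernel-preimage {K} f f-hom f-involutive kK = record
    { independent = λ Kfx Kfy x⟶y → independent kK Kfx Kfy (f-hom x⟶y)
    ; absorbing   = absorbing′
    }
    where
    absorbing′ : ∀ x → K (f x) ⊎ ∃[ y ] x ⟶ y × K (f y)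
    absorbing′ x with absorbing kK (f x)
    ... | inj₁ Kfx = inj₁ Kfx
    ... | inj₂ (y , fx⟶y , Ky) =
      inj₂ (f y , subst (_⟶ f y) (f-involutive x) (f-hom fx⟶y) , subst K (sym (f-involutive y)) Ky)

  module _ {K L : Pred A 0ℓ} (kK : IsKernel K) (kL : IsKernel L) where

    kernel-⊆ : ∀ {x} → (∀ {y} → x ⟶ y → L y → K y) → K x → L x
    kernel-⊆ {x} L⇒K Kx with absorbing kL x
    ... | inj₁ Lx = Lx
    ... | inj₂ (y , x⟶y , Ly) = ⊥-elim (independent kK Kx (L⇒K x⟶y Ly) x⟶y)

  kernel-unique : ∀ {K L} → WellFounded (flip _⟶_) → IsKernel K → IsKernel L →
                  ∀ x → (K x → L x) × (L x → K x)
  kernel-unique {K} {L} wf kK kL = All.wfRec wf 0ℓ (λ x → (K x → L x) × (L x → K x)) λ x ih →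
    kernel-⊆ kK kL (proj₂ ∘ ih) , kernel-⊆ kL kK (proj₁ ∘ ih)

c*a≡c*b+d⇒b≤a : ∀ c a b {d} → 0 < c → c * a ≡ c * b + d → b ≤ a
c*a≡c*b+d⇒b≤a c a b {d} 0<c e =
  *-cancelˡ-≤ c {{>-nonZero 0<c}} (subst (c * b ≤_) (sym e) (m≤m+n (c * b) d))

c*a≡c*b+d⇒c*[a∸b]≡d : ∀ c a b {d} → c * a ≡ c * b + d → c * (a ∸ b) ≡ d
c*a≡c*b+d⇒c*[a∸b]≡d c a b {d} e = begin
  c * (a ∸ b)       ≡⟨ *-distribˡ-∸ c a b ⟩
  c * a ∸ c * b     ≡⟨ cong (_∸ c * b) e ⟩
  c * b + d ∸ c * b ≡⟨ m+n∸m≡n (c * b) d ⟩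
  d                 ∎
  where open ≡-Reasoning

c*[a∸b]≡d⇒c*a≡c*b+d : ∀ c a b {d} → b ≤ a → c * (a ∸ b) ≡ d → c * a ≡ c * b + d
c*[a∸b]≡d⇒c*a≡c*b+d c a b {d} b≤a e = begin
  c * a               ≡⟨ cong (c *_) (sym (m+[n∸m]≡n b≤a)) ⟩
  c * (b + (a ∸ b))   ≡⟨ *-distribˡ-+ c b (a ∸ b) ⟩
  c * b + c * (a ∸ b) ≡⟨ cong (c * b +_) e ⟩
  c * b + d           ∎
  where open ≡-Reasoning

module _ {k} (Q : MoveSet k) where

  -- The displacement (a , b) is a rational (not necessarily integer) multiple
  -- of some (p_i , q_i) or (q_i , p_i), exactly as Forbidden encodes it.
  Direction : ℕ → ℕ → Set
  Direction a b = ∃[ i ] (q Q i * b ≡ p Q i * a ⊎ p Q i * b ≡ q Q i * a)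

  Direction-swap : ∀ {a b} → Direction a b → Direction b a
  Direction-swap (i , inj₁ e) = i , inj₂ (sym e)
  Direction-swap (i , inj₂ e) = i , inj₁ (sym e)

  Direction-vertical : ∀ b → Direction 0 b
  Direction-vertical b = Fin.zero , inj₂ (trans (cong (_* b) (p0 Q)) (sym (*-zeroʳ (q Q Fin.zero))))

  _⟶_ : Rel (ℕ × ℕ) 0ℓ
  (u , v) ⟶ (u′ , v′) = u′ ≤ u × v′ ≤ v × u′ + v′ < u + v × Direction (u ∸ u′) (v ∸ v′)

  ⟶-swap : ∀ {x y} → x ⟶ y → swap x ⟶ swap y
  ⟶-swap {u , v} {u′ , v′} (u′≤u , v′≤v , lt , d) =
    v′≤v , u′≤u , subst₂ _<_ (+-comm u′ v′) (+-comm u v) lt , Direction-swap d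

  ⟶-wellFounded : WellFounded (flip _⟶_)
  ⟶-wellFounded = Subrelation.wellFounded (proj₁ ∘ proj₂ ∘ proj₂) (On.wellFounded (uncurry _+_) <-wellFounded)

  ⟶-left : ∀ {u v u′ v′} → u′ < u → v′ ≤ v → Direction (u ∸ u′) (v ∸ v′) → (u , v) ⟶ (u′ , v′)
  ⟶-left u′<u v′≤v d = <⇒≤ u′<u , v′≤v , +-mono-<-≤ u′<u v′≤v , d

  ⟶-down : ∀ {u v v′} → v′ < v → (u , v) ⟶ (u , v′)
  ⟶-down {u} {v} {v′} v′<v =
    ≤-refl , <⇒≤ v′<v , +-monoʳ-< u v′<v , subst (λ a → Direction a (v ∸ v′)) (sym (n∸n≡0 u)) (Direction-vertical _)

  module _ (π : ℕ → ℕ) where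

    graph : Pred (ℕ × ℕ) 0ℓ
    graph (u , v) = v ≡ π u

    forbidden⇒⟶ : ∀ {n m} → Forbidden Q π n m → ∃[ j ] j < n × (n , m) ⟶ (j , π j)
    forbidden⇒⟶ {n} {m} (i , j , j<n , inj₁ e) =
      j , j<n , ⟶-left j<n (c*a≡c*b+d⇒b≤a (q Q i) m (π j) (q-pos Q i) e)
                            (i , inj₁ (c*a≡c*b+d⇒c*[a∸b]≡d (q Q i) m (π j) e))
    forbidden⇒⟶ {n} {m} (i , j , j<n , inj₂ (0<p , _ , e)) =
      j , j<n , ⟶-left j<n (c*a≡c*b+d⇒b≤a (p Q i) m (π j) 0<p e)
                            (i , inj₂ (c*a≡c*b+d⇒c*[a∸b]≡d (p Q i) m (π j) e))

    ⟶⇒forbidden : ∀ {n m j} → j < n → (n , m) ⟶ (j , π j) → Forbidden Q π n m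
    ⟶⇒forbidden {n} {m} {j} j<n (_ , πj≤m , _ , i , inj₁ e) =
      i , j , j<n , inj₁ (c*[a∸b]≡d⇒c*a≡c*b+d (q Q i) m (π j) πj≤m e)
    ⟶⇒forbidden {n} {m} {j} j<n (_ , πj≤m , _ , i , inj₂ e) with p Q i ≟ 0 | p Q i ≟ q Q i
    ... | yes p≡0 | _ = ⊥-elim (<⇒≢ (m<n⇒0<n∸m j<n) (sym n∸j≡0))
      where
      n∸j≡0 : n ∸ j ≡ 0
      n∸j≡0 = m*n≡0⇒m≡0 (n ∸ j) (q Q i) {{>-nonZero (q-pos Q i)}}
                (trans (*-comm (n ∸ j) (q Q i)) (trans (sym e) (cong (_* (m ∸ π j)) p≡0)))
    ... | no _ | yes p≡q = i , j , j<n , inj₁ (c*[a∸b]≡d⇒c*a≡c*b+d (q Q i) m (π j) πj≤m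
            (trans (cong (_* (m ∸ π j)) (sym p≡q)) (trans e (cong (_* (n ∸ j)) (sym p≡q)))))
    ... | no p≢0 | no p≢q =
      i , j , j<n , inj₂ (n≢0⇒n>0 p≢0 , p≢q , c*[a∸b]≡d⇒c*a≡c*b+d (p Q i) m (π j) πj≤m e)

    module _ (isPi : IsPi Q π) where

      graph-isKernel : IsKernel _⟶_ graph
      graph-isKernel = record { independent = independent ; absorbing = absorbing }
        where
        independent : ∀ {x y} → graph x → graph y → ¬ x ⟶ y
        independent {u , _} {u′ , _} refl refl x⟶y@(u′≤u , _ , lt , _) with m≤n⇒m<n∨m≡n u′≤u
        ... | inj₁ u′<u = proj₁ (isPi u) (⟶⇒forbidden u′<u x⟶y)
        ... | inj₂ refl = <-irrefl refl lt

        absorbing : ∀ x → graph x ⊎ ∃[ y ] x ⟶ y × graph y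
        absorbing (u , v) with <-cmp v (π u)
        ... | tri≈ _ v≡πu _ = inj₁ v≡πu
        ... | tri> _ _ πu<v = inj₂ ((u , π u) , ⟶-down πu<v , refl)
        ... | tri< v<πu _ _ with forbidden⇒⟶ (proj₂ (isPi u) v v<πu)
        ...   | j , _ , x⟶y = inj₂ ((j , π j) , x⟶y , refl)

      π-involutive : ∀ n → π (π n) ≡ n
      π-involutive n = sym (proj₁ (kernel-unique _⟶_ ⟶-wellFounded graph-isKernel graph-swapped-isKernel (n , π n)) refl)
        where
        graph-swapped-isKernel : IsKernel _⟶_ (graph ∘ swap)
        graph-swapped-isKernel = kernel-preimage _⟶_ swap ⟶-swap (λ _ → refl) graph-isKernel

module _ (π : ℕ → ℕ) (π-involutive : ∀ n → π (π n) ≡ n) where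

  below : ℕ → ℕ
  below N = count (λ n → n ≤? π n) (suc N)

  above : ℕ → ℕ
  above N = count (λ n → N <? π n) (suc N)

  above-suc-≤ : ∀ N → above (suc N) ≤ suc (above N)
  above-suc-≤ N = ≤-trans (count-suc-≤ (λ n → suc N <? π n) (suc N))
                          (s≤s (count-mono (λ n → suc N <? π n) (λ n → N <? π n) (λ _ → <-trans (n<1+n N))))

  -- The witness is π (suc N): it is counted in above N but not in above (suc N).
  above-suc-< : ∀ N → π (suc N) ≤ N → suc (above (suc N)) ≤ above N
  above-suc-< N π[1+N]≤N = begin
    suc (above (suc N))                          ≡⟨ cong suc (count-suc-no (λ n → suc N <? π n) (λ lt → <⇒≱ lt (m≤n⇒m≤1+n π[1+N]≤N))) ⟩
    suc (count (λ n → suc N <? π n) (suc N))     ≤⟨ count-< (λ n → suc N <? π n) (λ n → N <? π n) (λ _ → <-trans (n<1+n N)) (s≤s π[1+N]≤N)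
                                                      (<-irrefl (sym (π-involutive (suc N))))
                                                      (subst (N <_) (sym (π-involutive (suc N))) (n<1+n N)) ⟩
    above N                                      ∎
    where open ≤-Reasoning

  below-above-invariant : ∀ N → suc N + above N ≤ 2 * below N
  below-above-invariant zero = begin
    suc (above 0)   ≤⟨ s≤s (count-suc-≤ (λ n → 0 <? π n) 0) ⟩
    2               ≡⟨ cong (2 *_) (sym (count-suc-yes (λ n → n ≤? π n) z≤n)) ⟩
    2 * below 0     ∎
    where open ≤-Reasoning
  below-above-invariant (suc N) with ≤-<-connex (suc N) (π (suc N))
  ... | inj₁ 1+N≤π[1+N] = begin
    suc (suc N) + above (suc N)  ≤⟨ +-monoʳ-≤ (suc (suc N)) (above-suc-≤ N) ⟩
    suc (suc N) + suc (above N)  ≡⟨ cong (suc ∘ suc) (+-suc N (above N)) ⟩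
    2 + (suc N + above N)        ≤⟨ +-monoʳ-≤ 2 (below-above-invariant N) ⟩
    2 + 2 * below N              ≡⟨ sym (*-suc 2 (below N)) ⟩
    2 * suc (below N)            ≡⟨ cong (2 *_) (sym (count-suc-yes (λ n → n ≤? π n) 1+N≤π[1+N])) ⟩
    2 * below (suc N)            ∎
    where open ≤-Reasoning
  ... | inj₂ π[1+N]<1+N = begin
    suc (suc N) + above (suc N)  ≡⟨ sym (+-suc (suc N) (above (suc N))) ⟩
    suc N + suc (above (suc N))  ≤⟨ +-monoʳ-≤ (suc N) (above-suc-< N (≤-pred π[1+N]<1+N)) ⟩
    suc N + above N              ≤⟨ below-above-invariant N ⟩
    2 * below N                  ≡⟨ cong (2 *_) (sym (count-suc-no (λ n → n ≤? π n) (<⇒≱ π[1+N]<1+N))) ⟩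
    2 * below (suc N)            ∎
    where open ≤-Reasoning

  involution-countUpTo : ∀ N → N < 2 * countUpTo π N
  involution-countUpTo N = begin-strict
    N                     <⟨ n<1+n N ⟩
    suc N                 ≤⟨ m≤m+n (suc N) (above N) ⟩
    suc N + above N       ≤⟨ below-above-invariant N ⟩
    2 * below N           ≡⟨ cong (2 *_) (sym (length-filter-upTo (λ n → n ≤? π n) (suc N))) ⟩
    2 * countUpTo π N     ∎
    where open ≤-Reasoning

lemma3p2 : ∀ k (Q : MoveSet k) (π : ℕ → ℕ) → IsPi Q π →
    ∀ N → 1 ≤ N → N < 2 * countUpTo π N
lemma3p2 k Q π isPi N _ = involution-countUpTo π (π-involutive Q π isPi) N
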